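{- Let $p>2$ be a prime and $r>1$ an integer with $r\equiv 1\pmod{p-1}$, and put $t=v(r-1)$. Let $\mu\in\mathbb{F}_p$. Then, modulo $p^{t+2}\overline{\mathbb{Z}}_p[x,y]$, the polynomial $(-[\mu]x+py)^r-x^{r-1}(-[\mu]x+py)$ is congruent to $-px^{r-1}y$ if $\mu=0$, and to $(r-1)px^{r-1}y$ if $\mu\neq 0$.
   Context: $v$ is the $p$-adic valuation with $v(p)=1$; $\overline{\mathbb{Z}}_p$ is the ring of integers of an algebraic closure of $\mathbb{Q}_p$; for $\lambda\in\mathbb{F}_p$, $[\lambda]\in\mathbb{Z}_p$ denotes its Teichmüller lift; $x,y$ are indeterminates. -}

module Defs where

open import Data.Nat as ℕ using (ℕ; zero; suc; _∸_)
open import Data.Nat.Divisibility as ℕD using ()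
open import Data.Integer as ℤ using (ℤ; +_; _+_; _*_; -_; _-_; _^_)
open import Data.Integer.Divisibility as ℤD using ()
open import Data.Product using (_×_)
open import Relation.Nullary using (¬_; yes; no)

-- Bivariate polynomials over ℤ, given by coefficient functions:
-- f i j is the coefficient of x^i y^j.
Poly2 : Set
Poly2 = ℕ → ℕ → ℤ

sumTo : ℕ → (ℕ → ℤ) → ℤ
sumTo zero    f = f 0
sumTo (suc n) f = sumTo n f + f (suc n)

_⊕_ : Poly2 → Poly2 → Poly2
(f ⊕ g) i j = f i j + g i j

_⊖_ : Poly2 → Poly2 → Poly2
(f ⊖ g) i j = f i j - g i j

_⊗_ : Poly2 → Poly2 → Poly2
(f ⊗ g) m n = sumTo m (λ i → sumTo n (λ j → f i j * g (m ∸ i) (n ∸ j)))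

mono : ℤ → ℕ → ℕ → Poly2
mono c a b i j with i ℕ.≟ a | j ℕ.≟ b
... | yes _ | yes _ = c
... | _     | _     = + 0

X : Poly2
X = mono (+ 1) 1 0

Y : Poly2
Y = mono (+ 1) 0 1

scale : ℤ → Poly2 → Poly2
scale c f i j = c * f i j

pow : Poly2 → ℕ → Poly2
pow f zero    = mono (+ 1) 0 0
pow f (suc n) = f ⊗ pow f n

_≈_[mod_] : Poly2 → Poly2 → ℤ → Set
f ≈ g [mod m ] = ∀ i j → m ℤD.∣ (f i j - g i j)

IsPadicVal : ℕ → ℕ → ℕ → Set
IsPadicVal p n t = ((p ℕ.^ t) ℕD.∣ n) × ¬ ((p ℕ.^ suc t) ℕD.∣ n)

-- w ∈ ℤ represents the Teichmüller lift [μ] ∈ ℤ_p modulo p^N: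
-- [μ] is the unique root of w^p = w in ℤ_p with w ≡ μ (mod p);
-- modulo p^N its residue is the unique class with these properties.
IsTeichLiftMod : ℕ → ℕ → ℕ → ℤ → Set
IsTeichLiftMod p N μ w = ((+ p) ℤD.∣ (w - + μ)) × ((+ p) ^ N ℤD.∣ (w ^ p - w))

{-# OPTIONS --safe #-}
module Submission where

-- Put a = −[μ], b = p and L = a x + b y; the claim compares the coefficients of L^r − x^{r−1} L
-- with those of c x^{r−1} y. Only the monomials of degree r occur. At x^r the coefficient is
-- a^r − a = a (a^{r−1} − 1), at x^{r−1} y it is r a^{r−1} p − p, and after subtracting c both are
-- multiples of a when μ = 0 (then p^{t+2} ∣ [μ], since [μ]^{p−1} − 1 is a unit) or of a^{r−1} − 1
-- when μ ≠ 0 (then [μ]^{p−1} ≡ 1, p − 1 ∣ r − 1 and p − 1 is even). Every remaining coefficient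
-- is C(r,j) a^{r−j} p^j with j ≥ 2, and j (j−1) C(r,j) = r (r−1) C(r−2,j−2) with p^t ∣ r − 1 gives
-- v(C(r,j)) ≥ t − v(j (j−1)) ≥ t + 2 − j: as p is odd it divides at most one of j and j − 1,
-- and that one is smaller than p^{j−1}.

module BinomialValuation where
  open import Data.Nat using (ℕ; zero; suc; _+_; _*_; _^_; _<_; NonZero)
  open import Data.Nat.Properties
  open import Data.Nat.Divisibility
  open import Data.Nat.Primality using (Prime; euclidsLemma; prime⇒nonZero; ¬prime[1])
  open import Data.Nat.Combinatorics using (_C_; nC1≡n; nCk+nC[k+1]≡[n+1]C[k+1])
  open import Data.Nat.Tactic.RingSolver using (solve-∀)
  open import Data.Sum using (inj₁; inj₂)
  open import Function using (_∘_)
  open import Relation.Binary.PropositionalEquality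
  open import Relation.Nullary using (yes; no; contradiction)

  module _ {p : ℕ} (p-prime : Prime p) where

    private instance
      p≢0 : NonZero p
      p≢0 = prime⇒nonZero p-prime

    pᵗ∣m*c⇒pᵗ∣c : ∀ {m} t c → p ∤ m → p ^ t ∣ m * c → p ^ t ∣ c
    pᵗ∣m*c⇒pᵗ∣c zero    c p∤m _ = 1∣ c
    pᵗ∣m*c⇒pᵗ∣c {m} (suc t) c p∤m pᵗ⁺¹∣m*c
      with euclidsLemma m c p-prime (∣-trans (m∣m*n (p ^ t)) pᵗ⁺¹∣m*c)
    ... | inj₁ p∣m            = contradiction p∣m p∤m
    ... | inj₂ (divides q refl) = subst (p * p ^ t ∣_) (*-comm p q) (*-monoʳ-∣ p pᵗ∣q)
      where
      pᵗ∣q : p ^ t ∣ q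
      pᵗ∣q = pᵗ∣m*c⇒pᵗ∣c t q p∤m
        (*-cancelˡ-∣ p (subst (p * p ^ t ∣_) (rearrange m q p) pᵗ⁺¹∣m*c))
        where
        rearrange : ∀ m q p → m * (q * p) ≡ p * (m * q)
        rearrange = solve-∀

    pᵗ∣m*c⇒pᵗ∣pᵉ*c : ∀ e {m} t c → p ^ suc e ∤ m → p ^ t ∣ m * c → p ^ t ∣ p ^ e * c
    pᵗ∣m*c⇒pᵗ∣pᵉ*c zero {m} t c p∤m pᵗ∣m*c =
      subst (p ^ t ∣_) (sym (+-identityʳ c))
        (pᵗ∣m*c⇒pᵗ∣c t c (p∤m ∘ subst (_∣ m) (sym (*-identityʳ p))) pᵗ∣m*c)
    pᵗ∣m*c⇒pᵗ∣pᵉ*c (suc e) {m} t c pᵉ⁺²∤m pᵗ∣m*c with p ∣? m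
    ... | no p∤m               = ∣n⇒∣m*n (p ^ suc e) (pᵗ∣m*c⇒pᵗ∣c t c p∤m pᵗ∣m*c)
    ... | yes (divides q refl) = subst (p ^ t ∣_) (rearrange (p ^ e) p c) pᵗ∣pᵉ*p*c
      where
      pᵗ∣pᵉ*p*c : p ^ t ∣ p ^ e * (p * c)
      pᵗ∣pᵉ*p*c = pᵗ∣m*c⇒pᵗ∣pᵉ*c e t (p * c)
        (pᵉ⁺²∤m ∘ subst (p * p ^ suc e ∣_) (*-comm p q) ∘ *-monoʳ-∣ p)
        (subst (p ^ t ∣_) (*-assoc q p c) pᵗ∣m*c)
      rearrange : ∀ P p c → P * (p * c) ≡ p * P * c
      rearrange = solve-∀

  [1+k]*[1+n]C[1+k]≡[1+n]*nCk : ∀ n k → suc k * (suc n C suc k) ≡ suc n * (n C k)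
  [1+k]*[1+n]C[1+k]≡[1+n]*nCk zero    zero    = refl
  [1+k]*[1+n]C[1+k]≡[1+n]*nCk zero    (suc k) = *-zeroʳ (2 + k)
  [1+k]*[1+n]C[1+k]≡[1+n]*nCk (suc n) zero    =
    trans (+-identityʳ _) (trans (nC1≡n (2 + n)) (sym (*-identityʳ (2 + n))))
  [1+k]*[1+n]C[1+k]≡[1+n]*nCk (suc n) (suc k) = begin
    (2 + k) * ((2 + n) C (2 + k))
      ≡⟨ cong ((2 + k) *_) (nCk+nC[k+1]≡[n+1]C[k+1] (suc n) (suc k)) ⟨
    (2 + k) * (C₁ + C₂)
      ≡⟨ split k C₁ C₂ ⟩
    (1 + k) * C₁ + C₁ + (2 + k) * C₂
      ≡⟨ cong₂ (λ x y → x + C₁ + y) ([1+k]*[1+n]C[1+k]≡[1+n]*nCk n k) ([1+k]*[1+n]C[1+k]≡[1+n]*nCk n (suc k)) ⟩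
    (1 + n) * (n C k) + C₁ + (1 + n) * (n C suc k)
      ≡⟨ cong (λ x → (1 + n) * (n C k) + x + (1 + n) * (n C suc k)) pascal ⟨
    (1 + n) * (n C k) + (n C k + n C suc k) + (1 + n) * (n C suc k)
      ≡⟨ merge n (n C k) (n C suc k) ⟩
    (2 + n) * (n C k + n C suc k)
      ≡⟨ cong ((2 + n) *_) pascal ⟩
    (2 + n) * C₁ ∎
    where
    open ≡-Reasoning
    C₁ = suc n C suc k
    C₂ = suc n C suc (suc k)
    pascal : n C k + n C suc k ≡ C₁
    pascal = nCk+nC[k+1]≡[n+1]C[k+1] n k
    split : ∀ k x y → (2 + k) * (x + y) ≡ (1 + k) * x + x + (2 + k) * y
    split = solve-∀
    merge : ∀ n x y → (1 + n) * x + (x + y) + (1 + n) * y ≡ (2 + n) * (x + y)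
    merge = solve-∀

  module _ {p : ℕ} (p-prime : Prime p) (2<p : 2 < p) where

    private instance
      p≢0 : NonZero p
      p≢0 = prime⇒nonZero p-prime

    2+k<p^[1+k] : ∀ k → 2 + k < p ^ suc k
    2+k<p^[1+k] zero    = subst (2 <_) (sym (*-identityʳ p)) 2<p
    2+k<p^[1+k] (suc k) = subst (3 + k <_) (*-comm (p ^ suc k) p)
      (≤-<-trans (2+k<p^[1+k] k) (m<m*n (p ^ suc k) p (<-trans (n<1+n 1) 2<p)))
      where instance _ = m^n≢0 p (suc k)

    p^[1+k]∤[2+k]*[1+k] : ∀ k → p ^ suc k ∤ (2 + k) * (1 + k)
    p^[1+k]∤[2+k]*[1+k] k p^[1+k]∣ with p ∣? 2 + k
    ... | no p∤2+k  = >⇒∤ (<-trans (n<1+n (1 + k)) (2+k<p^[1+k] k))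
      (pᵗ∣m*c⇒pᵗ∣c p-prime (suc k) (1 + k) p∤2+k p^[1+k]∣)
    ... | yes p∣2+k = >⇒∤ (2+k<p^[1+k] k)
      (pᵗ∣m*c⇒pᵗ∣c p-prime (suc k) (2 + k) p∤1+k (subst (p ^ suc k ∣_) (*-comm (2 + k) (1 + k)) p^[1+k]∣))
      where
      p∤1+k : p ∤ 1 + k
      p∤1+k p∣1+k =
        ¬prime[1] (subst Prime (∣1⇒≡1 (∣m+n∣m⇒∣n (subst (p ∣_) (+-comm 1 (1 + k)) p∣2+k) p∣1+k)) p-prime)

    p^[t+2]∣[2+n]C[2+k]*p^[2+k] : ∀ t n k → p ^ t ∣ suc n →
      p ^ (t + 2) ∣ ((2 + n) C (2 + k)) * p ^ (2 + k)
    p^[t+2]∣[2+n]C[2+k]*p^[2+k] t n k p^t∣1+n =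
      subst₂ _∣_ (sym (^-distribˡ-+-* p t 2)) (rearrange p (p ^ k) binom)
        (*-monoˡ-∣ (p ^ 2) (pᵗ∣m*c⇒pᵗ∣pᵉ*c p-prime k t binom (p^[1+k]∤[2+k]*[1+k] k) p^t∣[2+k][1+k]binom))
      where
      binom = (2 + n) C (2 + k)
      double-absorption : (2 + k) * (1 + k) * binom ≡ (2 + n) * (1 + n) * (n C k)
      double-absorption = begin
        (2 + k) * (1 + k) * binom                ≡⟨ swap (2 + k) (1 + k) binom ⟩
        (1 + k) * ((2 + k) * binom)              ≡⟨ cong ((1 + k) *_) ([1+k]*[1+n]C[1+k]≡[1+n]*nCk (suc n) (suc k)) ⟩
        (1 + k) * ((2 + n) * (suc n C suc k))    ≡⟨ swap (2 + n) (1 + k) (suc n C suc k) ⟨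
        (2 + n) * (1 + k) * (suc n C suc k)      ≡⟨ *-assoc (2 + n) (1 + k) _ ⟩
        (2 + n) * ((1 + k) * (suc n C suc k))    ≡⟨ cong ((2 + n) *_) ([1+k]*[1+n]C[1+k]≡[1+n]*nCk n k) ⟩
        (2 + n) * ((1 + n) * (n C k))            ≡⟨ *-assoc (2 + n) (1 + n) (n C k) ⟨
        (2 + n) * (1 + n) * (n C k)              ∎
        where
        open ≡-Reasoning
        swap : ∀ x y z → x * y * z ≡ y * (x * z)
        swap = solve-∀
      p^t∣[2+k][1+k]binom : p ^ t ∣ (2 + k) * (1 + k) * binom
      p^t∣[2+k][1+k]binom =
        subst (p ^ t ∣_) (sym double-absorption) (∣m⇒∣m*n (n C k) (∣n⇒∣m*n (2 + n) p^t∣1+n))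
      rearrange : ∀ p P c → P * c * (p * (p * 1)) ≡ c * (p * (p * P))
      rearrange = solve-∀


module Polynomials where
  open import Defs
  open import Data.Nat as ℕ using (ℕ; zero; suc; _∸_; z≤n)
  import Data.Nat.Properties as ℕP
  open import Data.Nat.Combinatorics using (_C_; nCn≡1; nC1≡n; nCk+nC[k+1]≡[n+1]C[k+1])
  open import Data.Integer as ℤ using (ℤ; +_; -_; _+_; _-_; _*_; _^_; 0ℤ; 1ℤ)
  open import Data.Integer.Divisibility.Signed using (_∣_; divides; ∣⇒∣ᵤ; ∣m⇒∣m*n; ∣n⇒∣m*n)
  import Data.Integer.Properties as ℤP
  open import Data.Integer.Tactic.RingSolver using (solve-∀)
  open import Data.Product using (_×_; _,_; proj₁; proj₂)
  open import Function using (_∘_)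
  open import Relation.Binary.PropositionalEquality
  open import Relation.Nullary using (¬_; yes; no; contradiction; _×-dec_)

  infix 4 _≗₂_
  _≗₂_ : Poly2 → Poly2 → Set
  f ≗₂ g = ∀ i j → f i j ≡ g i j

  sumTo-cong : ∀ n {f g : ℕ → ℤ} → (∀ i → i ℕ.≤ n → f i ≡ g i) → sumTo n f ≡ sumTo n g
  sumTo-cong zero    f≡g = f≡g 0 z≤n
  sumTo-cong (suc n) f≡g =
    cong₂ _+_ (sumTo-cong n (λ i i≤n → f≡g i (ℕP.m≤n⇒m≤1+n i≤n))) (f≡g (suc n) ℕP.≤-refl)

  sumTo-suc : ∀ n (f : ℕ → ℤ) → sumTo (suc n) f ≡ f 0 + sumTo n (λ i → f (suc i))
  sumTo-suc zero    f = refl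
  sumTo-suc (suc n) f =
    trans (cong (_+ f (suc (suc n))) (sumTo-suc n f)) (ℤP.+-assoc (f 0) _ _)

  sumTo-head : ∀ n (f : ℕ → ℤ) → (∀ i → f (suc i) ≡ 0ℤ) → sumTo n f ≡ f 0
  sumTo-head zero    f tail≡0 = refl
  sumTo-head (suc n) f tail≡0 =
    trans (cong₂ _+_ (sumTo-head n f tail≡0) (tail≡0 n)) (ℤP.+-identityʳ (f 0))

  sumTo-reverse : ∀ n (f : ℕ → ℤ) → sumTo n f ≡ sumTo n (λ i → f (n ∸ i))
  sumTo-reverse zero    f = refl
  sumTo-reverse (suc n) f = begin
    sumTo n f + f (suc n)                        ≡⟨ cong (_+ f (suc n)) (sumTo-reverse n f) ⟩
    sumTo n (λ i → f (n ∸ i)) + f (suc n)        ≡⟨ ℤP.+-comm _ (f (suc n)) ⟩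
    f (suc n) + sumTo n (λ i → f (n ∸ i))        ≡⟨ sumTo-suc n (λ i → f (suc n ∸ i)) ⟨
    sumTo (suc n) (λ i → f (suc n ∸ i))          ∎
    where open ≡-Reasoning

  ⊗-comm : ∀ f g → f ⊗ g ≗₂ g ⊗ f
  ⊗-comm f g m n =
    trans (sumTo-reverse m _) (sumTo-cong m λ i i≤m →
    trans (sumTo-reverse n _) (sumTo-cong n λ j j≤n →
    trans (cong₂ (λ k l → f (m ∸ i) (n ∸ j) * g k l) (ℕP.m∸[m∸n]≡n i≤m) (ℕP.m∸[m∸n]≡n j≤n))
          (ℤP.*-comm (f (m ∸ i) (n ∸ j)) (g i j))))

  ⊗-congˡ : ∀ {f f′} g → f ≗₂ f′ → f ⊗ g ≗₂ f′ ⊗ g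
  ⊗-congˡ g f≗f′ m n =
    sumTo-cong m λ i _ → sumTo-cong n λ j _ → cong (_* g (m ∸ i) (n ∸ j)) (f≗f′ i j)

  mono-≡ : ∀ c a b → mono c a b a b ≡ c
  mono-≡ c a b with a ℕ.≟ a | b ℕ.≟ b
  ... | yes _   | yes _   = refl
  ... | no a≢a  | _       = contradiction refl a≢a
  ... | yes _   | no b≢b  = contradiction refl b≢b

  mono-≢ : ∀ c a b i j → ¬ (i ≡ a × j ≡ b) → mono c a b i j ≡ 0ℤ
  mono-≢ c a b i j ≢ab with i ℕ.≟ a | j ℕ.≟ b
  ... | yes i≡a | yes j≡b = contradiction (i≡a , j≡b) ≢ab
  ... | no _    | _       = refl
  ... | yes _   | no _    = refl

  mono-zero : ∀ m k → mono 0ℤ m k ≗₂ λ _ _ → 0ℤ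
  mono-zero m k i j with i ℕ.≟ m | j ℕ.≟ k
  ... | yes _ | yes _ = refl
  ... | no _  | _     = refl
  ... | yes _ | no _  = refl

  -- a x + b y by pattern matching, so that its zero coefficients vanish definitionally in ⊗.
  linear : ℤ → ℤ → Poly2
  linear a b 0 1 = b
  linear a b 1 0 = a
  linear a b _ _ = 0ℤ

  shiftX : ℤ → Poly2 → Poly2
  shiftX a g zero    j = 0ℤ
  shiftX a g (suc i) j = a * g i j

  shiftY : ℤ → Poly2 → Poly2
  shiftY b g i zero    = 0ℤ
  shiftY b g i (suc j) = b * g i j

  shiftX-cong : ∀ c {f g} → f ≗₂ g → shiftX c f ≗₂ shiftX c g
  shiftX-cong c f≗g zero    j = refl
  shiftX-cong c f≗g (suc i) j = cong (c *_) (f≗g i j)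

  shiftY-cong : ∀ c {f g} → f ≗₂ g → shiftY c f ≗₂ shiftY c g
  shiftY-cong c f≗g i zero    = refl
  shiftY-cong c f≗g i (suc j) = cong (c *_) (f≗g i j)

  linear-⊗ : ∀ {L} a b g → L ≗₂ linear a b → L ⊗ g ≗₂ λ i j → shiftX a g i j + shiftY b g i j
  linear-⊗ a b g L≗ m n = trans (⊗-congˡ g L≗ m n) (product m)
    where
    y-row : ∀ i n → sumTo n (λ j → linear a b 0 j * g i (n ∸ j)) ≡ shiftY b g i n
    y-row i zero    = refl
    y-row i (suc n) = trans (sumTo-suc n _) (trans (ℤP.+-identityˡ _) (sumTo-head n _ λ _ → refl))

    x-row : ∀ i → sumTo n (λ j → linear a b 1 j * g i (n ∸ j)) ≡ a * g i n
    x-row i = sumTo-head n _ λ _ → refl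

    product : ∀ m → (linear a b ⊗ g) m n ≡ shiftX a g m n + shiftY b g m n
    product zero    = trans (y-row 0 n) (sym (ℤP.+-identityˡ _))
    product (suc m) = begin
      (linear a b ⊗ g) (suc m) n
        ≡⟨ sumTo-suc m _ ⟩
      sumTo n (λ j → linear a b 0 j * g (suc m) (n ∸ j))
        + sumTo m (λ i → sumTo n (λ j → linear a b (suc i) j * g (m ∸ i) (n ∸ j)))
        ≡⟨ cong₂ _+_ (y-row (suc m) n)
                     (trans (sumTo-head m _ λ _ → sumTo-head n _ λ _ → refl) (x-row m)) ⟩
      shiftY b g (suc m) n + a * g m n
        ≡⟨ ℤP.+-comm (shiftY b g (suc m) n) (a * g m n) ⟩
      shiftX a g (suc m) n + shiftY b g (suc m) n ∎
      where open ≡-Reasoning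

  X≗linear : X ≗₂ linear 1ℤ 0ℤ
  X≗linear 0 0 = refl
  X≗linear 0 1 = refl
  X≗linear 0 (suc (suc j)) = refl
  X≗linear 1 0 = refl
  X≗linear 1 (suc j) = refl
  X≗linear (suc (suc i)) j = refl

  private
    vanishes : ∀ a b → a * 0ℤ + b * 0ℤ ≡ 0ℤ
    vanishes = solve-∀

    x-coefficient : ∀ a b → a * 1ℤ + b * 0ℤ ≡ a
    x-coefficient = solve-∀

    y-coefficient : ∀ a b → a * 0ℤ + b * 1ℤ ≡ b
    y-coefficient = solve-∀

  scale-linear : ∀ a b → scale a X ⊕ scale b Y ≗₂ linear a b
  scale-linear a b 0             0             = vanishes a b
  scale-linear a b 0             1             = y-coefficient a b
  scale-linear a b 0             (suc (suc j)) = vanishes a b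
  scale-linear a b 1             0             = x-coefficient a b
  scale-linear a b 1             (suc j)       = vanishes a b
  scale-linear a b (suc (suc i)) j             = vanishes a b

  module _ {L : Poly2} {a b : ℤ} (L≗ : L ≗₂ linear a b) where

    pow-linear-suc : ∀ n → pow L (suc n) ≗₂ λ i j → shiftX a (pow L n) i j + shiftY b (pow L n) i j
    pow-linear-suc n = linear-⊗ a b (pow L n) L≗

    pow-linear-off-diagonal : ∀ n i j → i ℕ.+ j ≢ n → pow L n i j ≡ 0ℤ
    pow-linear-off-diagonal zero    i j i+j≢0 = mono-≢ 1ℤ 0 0 i j λ { (refl , refl) → i+j≢0 refl }
    pow-linear-off-diagonal (suc n) i j i+j≢n =
      trans (pow-linear-suc n i j) (cong₂ _+_ (x-part i j i+j≢n) (y-part i j i+j≢n))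
      where
      x-part : ∀ i j → i ℕ.+ j ≢ suc n → shiftX a (pow L n) i j ≡ 0ℤ
      x-part zero    j _     = refl
      x-part (suc i) j i+j≢n =
        trans (cong (a *_) (pow-linear-off-diagonal n i j (i+j≢n ∘ cong suc))) (ℤP.*-zeroʳ a)
      y-part : ∀ i j → i ℕ.+ j ≢ suc n → shiftY b (pow L n) i j ≡ 0ℤ
      y-part i zero    _     = refl
      y-part i (suc j) i+j≢n =
        trans (cong (b *_) (pow-linear-off-diagonal n i j (i+j≢n ∘ trans (ℕP.+-suc i j) ∘ cong suc)))
              (ℤP.*-zeroʳ b)

    pow-linear-diagonal : ∀ i j {n} → i ℕ.+ j ≡ n → pow L n i j ≡ + (n C j) * (a ^ i * b ^ j)
    pow-linear-diagonal zero zero refl = refl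
    pow-linear-diagonal (suc i) zero refl =
      trans (pow-linear-suc (i ℕ.+ 0) (suc i) 0)
            (trans (cong (λ c → a * c + 0ℤ) (pow-linear-diagonal i 0 refl)) (x-step a (a ^ i)))
      where
      x-step : ∀ a A → a * (1ℤ * (A * 1ℤ)) + 0ℤ ≡ 1ℤ * ((a * A) * 1ℤ)
      x-step = solve-∀
    pow-linear-diagonal zero (suc j) refl = begin
      pow L (suc j) 0 (suc j)                   ≡⟨ pow-linear-suc j 0 (suc j) ⟩
      0ℤ + b * pow L j 0 j                      ≡⟨ cong (λ c → 0ℤ + b * c) (pow-linear-diagonal 0 j refl) ⟩
      0ℤ + b * (+ (j C j) * (1ℤ * b ^ j))       ≡⟨ cong (λ c → 0ℤ + b * (+ c * (1ℤ * b ^ j))) (nCn≡1 j) ⟩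
      0ℤ + b * (1ℤ * (1ℤ * b ^ j))              ≡⟨ y-step b (b ^ j) ⟩
      1ℤ * (1ℤ * (b * b ^ j))                   ≡⟨ cong (λ c → + c * (1ℤ * (b * b ^ j))) (nCn≡1 (suc j)) ⟨
      + (suc j C suc j) * (1ℤ * (b * b ^ j))    ∎
      where
      open ≡-Reasoning
      y-step : ∀ b B → 0ℤ + b * (1ℤ * (1ℤ * B)) ≡ 1ℤ * (1ℤ * (b * B))
      y-step = solve-∀
    pow-linear-diagonal (suc i) (suc j) refl = begin
      pow L (suc m) (suc i) (suc j)
        ≡⟨ pow-linear-suc m (suc i) (suc j) ⟩
      a * pow L m i (suc j) + b * pow L m (suc i) j
        ≡⟨ cong₂ (λ c d → a * c + b * d) (pow-linear-diagonal i (suc j) refl)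
                                         (pow-linear-diagonal (suc i) j (sym (ℕP.+-suc i j))) ⟩
      a * (+ (m C suc j) * (a ^ i * b ^ suc j)) + b * (+ (m C j) * (a ^ suc i * b ^ j))
        ≡⟨ pascal-step a b (a ^ i) (b ^ j) (+ (m C j)) (+ (m C suc j)) ⟩
      (+ (m C j) + + (m C suc j)) * (a ^ suc i * b ^ suc j)
        ≡⟨ cong (_* (a ^ suc i * b ^ suc j))
                (trans (sym (ℤP.pos-+ (m C j) (m C suc j))) (cong +_ (nCk+nC[k+1]≡[n+1]C[k+1] m j))) ⟩
      + (suc m C suc j) * (a ^ suc i * b ^ suc j) ∎
      where
      open ≡-Reasoning
      m = i ℕ.+ suc j
      pascal-step : ∀ a b A B c₀ c₁ →
        a * (c₁ * (A * (b * B))) + b * (c₀ * ((a * A) * B)) ≡ (c₀ + c₁) * ((a * A) * (b * B))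
      pascal-step = solve-∀

  mono-reindex : ∀ c {m k i j m′ k′ i′ j′} →
    (i ≡ m × j ≡ k → i′ ≡ m′ × j′ ≡ k′) → (i′ ≡ m′ × j′ ≡ k′ → i ≡ m × j ≡ k) →
    c * mono 1ℤ m k i j ≡ mono c m′ k′ i′ j′
  mono-reindex c {m} {k} {i} {j} {m′} {k′} {i′} {j′} to from with i ℕ.≟ m ×-dec j ℕ.≟ k
  ... | yes (refl , refl) with to (refl , refl)
  ...   | refl , refl =
    trans (cong (c *_) (mono-≡ 1ℤ i j)) (trans (ℤP.*-identityʳ c) (sym (mono-≡ c i′ j′)))
  mono-reindex c {m} {k} {i} {j} {m′} {k′} {i′} {j′} to from | no ≢mk =
    trans (cong (c *_) (mono-≢ 1ℤ m k i j ≢mk))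
          (trans (ℤP.*-zeroʳ c) (sym (mono-≢ c m′ k′ i′ j′ (≢mk ∘ from))))

  shiftX-mono : ∀ c m k → shiftX c (mono 1ℤ m k) ≗₂ mono c (suc m) k
  shiftX-mono c m k zero    j = sym (mono-≢ c (suc m) k 0 j λ ())
  shiftX-mono c m k (suc i) j =
    mono-reindex c (λ (i≡m , j≡k) → cong suc i≡m , j≡k) (λ (i≡m , j≡k) → ℕP.suc-injective i≡m , j≡k)

  shiftY-mono : ∀ c m k → shiftY c (mono 1ℤ m k) ≗₂ mono c m (suc k)
  shiftY-mono c m k i zero    = sym (mono-≢ c m (suc k) i 0 λ ())
  shiftY-mono c m k i (suc j) =
    mono-reindex c (λ (i≡m , j≡k) → i≡m , cong suc j≡k) (λ (i≡m , j≡k) → i≡m , ℕP.suc-injective j≡k)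

  linear-⊗-monomial : ∀ {L g} a b m k → L ≗₂ linear a b → g ≗₂ mono 1ℤ m k →
    L ⊗ g ≗₂ mono a (suc m) k ⊕ mono b m (suc k)
  linear-⊗-monomial {g = g} a b m k L≗ g≗ i j =
    trans (linear-⊗ a b g L≗ i j)
          (cong₂ _+_ (trans (shiftX-cong a g≗ i j) (shiftX-mono a m k i j))
                     (trans (shiftY-cong b g≗ i j) (shiftY-mono b m k i j)))

  pow-X : ∀ n → pow X n ≗₂ mono 1ℤ n 0
  pow-X zero    i j = refl
  pow-X (suc n) i j =
    trans (linear-⊗-monomial 1ℤ 0ℤ n 0 X≗linear (pow-X n) i j)
          (trans (cong (λ z → mono 1ℤ (suc n) 0 i j + z) (mono-zero n 1 i j)) (ℤP.+-identityʳ _))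

  pow-X-⊗-linear : ∀ a b n → pow X n ⊗ (scale a X ⊕ scale b Y) ≗₂ mono a (suc n) 0 ⊕ mono b n 1
  pow-X-⊗-linear a b n i j =
    trans (⊗-comm (pow X n) (scale a X ⊕ scale b Y) i j)
          (linear-⊗-monomial a b n 0 (scale-linear a b) (pow-X n) i j)

  module _ {a b c : ℤ} (n : ℕ) where

    private
      L : Poly2
      L = scale a X ⊕ scale b Y

      Δ : ℕ → ℕ → ℤ
      Δ i j = (pow L (suc n) i j - (pow X n ⊗ L) i j) - mono c n 1 i j

      Δ-shape : ∀ {i j u v w z} → pow L (suc n) i j ≡ u →
        mono a (suc n) 0 i j ≡ v → mono b n 1 i j ≡ w → mono c n 1 i j ≡ z → Δ i j ≡ (u - (v + w)) - z
      Δ-shape {i} {j} refl refl refl refl =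
        cong (λ e → (pow L (suc n) i j - e) - mono c n 1 i j) (pow-X-⊗-linear a b n i j)

      Δ-off-diagonal : ∀ i j → i ℕ.+ j ≢ suc n → Δ i j ≡ 0ℤ
      Δ-off-diagonal i j off = Δ-shape (pow-linear-off-diagonal (scale-linear a b) (suc n) i j off)
        (mono-≢ a (suc n) 0 i j λ { (refl , refl) → off (ℕP.+-identityʳ i) })
        (mono-≢ b n 1 i j λ { (refl , refl) → off (ℕP.+-comm i 1) })
        (mono-≢ c n 1 i j λ { (refl , refl) → off (ℕP.+-comm i 1) })

      Δ-x : Δ (suc n) 0 ≡ a ^ suc n - a
      Δ-x = trans (Δ-shape (pow-linear-diagonal (scale-linear a b) (suc n) 0 (ℕP.+-identityʳ (suc n)))
                    (mono-≡ a (suc n) 0) (mono-≢ b n 1 (suc n) 0 (ℕP.1+n≢n ∘ proj₁))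
                    (mono-≢ c n 1 (suc n) 0 (ℕP.1+n≢n ∘ proj₁)))
                  (rearrange (a ^ suc n) a)
        where
        rearrange : ∀ A a → (1ℤ * (A * 1ℤ) - (a + 0ℤ)) - 0ℤ ≡ A - a
        rearrange = solve-∀

      Δ-xy : Δ n 1 ≡ + suc n * (a ^ n * b) - b - c
      Δ-xy = trans (Δ-shape (pow-linear-diagonal (scale-linear a b) n 1 (ℕP.+-comm n 1))
                     (mono-≢ a (suc n) 0 n 1 ((λ ()) ∘ proj₂)) (mono-≡ b n 1) (mono-≡ c n 1))
                   (trans (cong (λ m → (+ m * (a ^ n * (b * 1ℤ)) - (0ℤ + b)) - c) (nC1≡n (suc n)))
                          (rearrange (+ suc n) (a ^ n) b c))
        where
        rearrange : ∀ m A b c → (m * (A * (b * 1ℤ)) - (0ℤ + b)) - c ≡ m * (A * b) - b - c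
        rearrange = solve-∀

      Δ-higher : ∀ i k → i ℕ.+ (2 ℕ.+ k) ≡ suc n →
        Δ i (2 ℕ.+ k) ≡ a ^ i * (+ (suc n C (2 ℕ.+ k)) * b ^ (2 ℕ.+ k))
      Δ-higher i k on = trans (Δ-shape (pow-linear-diagonal (scale-linear a b) i (2 ℕ.+ k) on)
                                  (mono-≢ a (suc n) 0 i (2 ℕ.+ k) ((λ ()) ∘ proj₂))
                                  (mono-≢ b n 1 i (2 ℕ.+ k) ((λ ()) ∘ proj₂))
                                  (mono-≢ c n 1 i (2 ℕ.+ k) ((λ ()) ∘ proj₂)))
                                (rearrange (+ (suc n C (2 ℕ.+ k))) (a ^ i) (b ^ (2 ℕ.+ k)))
        where
        rearrange : ∀ m A B → (m * (A * B) - (0ℤ + 0ℤ)) - 0ℤ ≡ A * (m * B)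
        rearrange = solve-∀

    linear-power-difference : ∀ {d} →
      d ∣ a ^ suc n - a →
      d ∣ + suc n * (a ^ n * b) - b - c →
      (∀ k → d ∣ + (suc n C (2 ℕ.+ k)) * b ^ (2 ℕ.+ k)) →
      (pow L (suc n) ⊖ (pow X n ⊗ L)) ≈ mono c n 1 [mod d ]
    linear-power-difference {d} x-cell xy-cell higher i j = ∣⇒∣ᵤ (cell i j)
      where
      cell : ∀ i j → d ∣ Δ i j
      cell i j with i ℕ.+ j ℕ.≟ suc n
      cell i j             | no off = subst (d ∣_) (sym (Δ-off-diagonal i j off)) (divides 0ℤ refl)
      cell i zero          | yes on with trans (sym (ℕP.+-identityʳ i)) on
      ... | refl = subst (d ∣_) (sym Δ-x) x-cell
      cell i (suc zero)    | yes on with ℕP.suc-injective (trans (ℕP.+-comm 1 i) on)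
      ... | refl = subst (d ∣_) (sym Δ-xy) xy-cell
      cell i (suc (suc k)) | yes on = subst (d ∣_) (sym (Δ-higher i k on)) (∣n⇒∣m*n (a ^ i) (higher k))


  x^[1+n]-x≡x*[x^n-1] : ∀ x n → x ^ suc n - x ≡ x * (x ^ n - 1ℤ)
  x^[1+n]-x≡x*[x^n-1] x n = factor x (x ^ n)
    where
    factor : ∀ x X → x * X - x ≡ x * (X - 1ℤ)
    factor = solve-∀

  module _ {a b d : ℤ} where

    linear-power-difference-∣a : ∀ n → d ∣ a →
      (∀ k → d ∣ + ((2 ℕ.+ n) C (2 ℕ.+ k)) * b ^ (2 ℕ.+ k)) →
      (pow (scale a X ⊕ scale b Y) (2 ℕ.+ n) ⊖ (pow X (suc n) ⊗ (scale a X ⊕ scale b Y)))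
        ≈ mono (- b) (suc n) 1 [mod d ]
    linear-power-difference-∣a n d∣a = linear-power-difference {a} {b} (suc n)
      (subst (d ∣_) (sym (x^[1+n]-x≡x*[x^n-1] a (suc n))) (∣m⇒∣m*n (a ^ suc n - 1ℤ) d∣a))
      (subst (d ∣_) (sym (rearrange (+ (2 ℕ.+ n)) a (a ^ n) b))
        (∣m⇒∣m*n (+ (2 ℕ.+ n) * (a ^ n * b)) d∣a))
      where
      rearrange : ∀ r a A b → r * ((a * A) * b) - b - (- b) ≡ a * (r * (A * b))
      rearrange = solve-∀

    linear-power-difference-unit : ∀ n → d ∣ a ^ n - 1ℤ →
      (∀ k → d ∣ + (suc n C (2 ℕ.+ k)) * b ^ (2 ℕ.+ k)) →
      (pow (scale a X ⊕ scale b Y) (suc n) ⊖ (pow X n ⊗ (scale a X ⊕ scale b Y)))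
        ≈ mono (+ n * b) n 1 [mod d ]
    linear-power-difference-unit n d∣aⁿ-1 = linear-power-difference {a} {b} n
      (subst (d ∣_) (sym (x^[1+n]-x≡x*[x^n-1] a n)) (∣n⇒∣m*n a d∣aⁿ-1))
      (subst (d ∣_) (sym (rearrange (+ n) (a ^ n) b)) (∣n⇒∣m*n ((1ℤ + + n) * b) d∣aⁿ-1))
      where
      -- 1ℤ + + n reduces to + suc n.
      rearrange : ∀ r A b → (1ℤ + r) * (A * b) - b - r * b ≡ ((1ℤ + r) * b) * (A - 1ℤ)
      rearrange = solve-∀

module TeichmüllerLifts where
  open import Defs using (IsTeichLiftMod)
  open import Data.Nat as ℕ using (ℕ; zero; suc; _∸_; s≤s)
  import Data.Nat.Properties as ℕP
  import Data.Nat.Divisibility as ℕD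
  open import Data.Nat.Primality using (Prime; prime⇒irreducible; ¬prime[1])
  open import Data.Nat.DivMod using (_%_; _/_; m≡m%n+[m/n]*n; m%n<n)
  open import Data.Nat.Combinatorics using (_C_)
  open import Data.Integer as ℤ using (ℤ; +_; -_; _+_; _-_; _*_; _^_; 1ℤ; ∣_∣)
  import Data.Integer.Properties as ℤP
  import Data.Integer.Divisibility as Unsigned
  open import Data.Integer.Divisibility.Signed
  open import Data.Integer.Tactic.RingSolver using (solve-∀)
  open import Data.Sum using (inj₁; inj₂)
  open import Data.Product using (_,_)
  open import Relation.Binary.PropositionalEquality
  open import Relation.Nullary using (¬_; contradiction)
  open BinomialValuation using (pᵗ∣m*c⇒pᵗ∣c; p^[t+2]∣[2+n]C[2+k]*p^[2+k])
  open Polynomials using (x^[1+n]-x≡x*[x^n-1])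

  pos-^ : ∀ m n → (+ m) ^ n ≡ + (m ℕ.^ n)
  pos-^ m zero    = refl
  pos-^ m (suc n) = trans (cong (+ m *_) (pos-^ m n)) (sym (ℤP.pos-* m (m ℕ.^ n)))

  binomial-term-∣ : ∀ {p t n} → Prime p → 2 ℕ.< p → p ℕ.^ t ℕD.∣ suc n →
    ∀ k → (+ p) ^ (t ℕ.+ 2) ∣ + ((2 ℕ.+ n) C (2 ℕ.+ k)) * (+ p) ^ (2 ℕ.+ k)
  binomial-term-∣ {p} {t} {n} p-prime 2<p pᵗ∣1+n k = ∣ᵤ⇒∣ (subst₂ Unsigned._∣_
    (sym (pos-^ p (t ℕ.+ 2)))
    (trans (ℤP.pos-* binom (p ℕ.^ (2 ℕ.+ k))) (cong (+ binom *_) (sym (pos-^ p (2 ℕ.+ k)))))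
    (p^[t+2]∣[2+n]C[2+k]*p^[2+k] p-prime 2<p t n k pᵗ∣1+n))
    where
    binom = (2 ℕ.+ n) C (2 ℕ.+ k)

  ∣x-1⇒∣x^n-1 : ∀ {d} x n → d ∣ x - 1ℤ → d ∣ x ^ n - 1ℤ
  ∣x-1⇒∣x^n-1 x zero    _     = divides (+ 0) refl
  ∣x-1⇒∣x^n-1 {d} x (suc n) d∣x-1 =
    subst (d ∣_) (sym (split x (x ^ n))) (∣m∣n⇒∣m+n (∣n⇒∣m*n x (∣x-1⇒∣x^n-1 x n d∣x-1)) d∣x-1)
    where
    split : ∀ x X → x * X - 1ℤ ≡ x * (X - 1ℤ) + (x - 1ℤ)
    split = solve-∀

  [-x]^n≡x^n : ∀ x {n} → 2 ℕD.∣ n → (- x) ^ n ≡ x ^ n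
  [-x]^n≡x^n x (ℕD.divides k refl) = begin
    (- x) ^ (k ℕ.* 2)  ≡⟨ cong ((- x) ^_) (ℕP.*-comm k 2) ⟩
    (- x) ^ (2 ℕ.* k)  ≡⟨ ℤP.^-*-assoc (- x) 2 k ⟨
    ((- x) ^ 2) ^ k    ≡⟨ cong (_^ k) (square x) ⟩
    (x ^ 2) ^ k        ≡⟨ ℤP.^-*-assoc x 2 k ⟩
    x ^ (2 ℕ.* k)      ≡⟨ cong (x ^_) (ℕP.*-comm 2 k) ⟩
    x ^ (k ℕ.* 2)      ∎
    where
    open ≡-Reasoning
    square : ∀ x → (- x) * ((- x) * 1ℤ) ≡ x * (x * 1ℤ)
    square = solve-∀

  ∣x^k-1⇒∣[-x]^m-1 : ∀ {d k m} x → 2 ℕD.∣ k → k ℕD.∣ m → d ∣ x ^ k - 1ℤ → d ∣ (- x) ^ m - 1ℤ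
  ∣x^k-1⇒∣[-x]^m-1 {d} {k} x 2∣k (ℕD.divides q refl) d∣x^k-1 = subst (λ z → d ∣ z - 1ℤ)
    (trans (ℤP.^-*-assoc x k q)
           (trans (cong (x ^_) (ℕP.*-comm k q)) (sym ([-x]^n≡x^n x (ℕD.∣n⇒∣m*n q 2∣k)))))
    (∣x-1⇒∣x^n-1 (x ^ k) q d∣x^k-1)

  odd-prime⇒2∣p-1 : ∀ {p} → Prime p → 2 ℕ.< p → 2 ℕD.∣ p ∸ 1
  odd-prime⇒2∣p-1 {p} p-prime 2<p with p % 2 | m≡m%n+[m/n]*n p 2 | m%n<n p 2
  ... | 0           | p≡[p/2]*2 | _ with prime⇒irreducible p-prime (ℕD.divides (p / 2) p≡[p/2]*2)
  ...   | inj₁ ()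
  ...   | inj₂ 2≡p = contradiction 2≡p (ℕP.<⇒≢ 2<p)
  odd-prime⇒2∣p-1 {p} p-prime 2<p | 1 | p≡1+[p/2]*2 | _ = ℕD.divides (p / 2) (cong (_∸ 1) p≡1+[p/2]*2)
  odd-prime⇒2∣p-1 {p} p-prime 2<p | suc (suc _) | _ | s≤s (s≤s ())

  +p∤x⇒+pᴺ∣x*y⇒+pᴺ∣y : ∀ {p} → Prime p → ∀ N {x} y →
    ¬ (+ p Unsigned.∣ x) → (+ p) ^ N Unsigned.∣ x * y → (+ p) ^ N Unsigned.∣ y
  +p∤x⇒+pᴺ∣x*y⇒+pᴺ∣y {p} p-prime N {x} y p∤x pᴺ∣x*y =
    subst (λ z → ∣ z ∣ ℕD.∣ ∣ y ∣) (sym (pos-^ p N))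
      (pᵗ∣m*c⇒pᵗ∣c p-prime N ∣ y ∣ p∤x (subst₂ ℕD._∣_ (cong ∣_∣ (pos-^ p N)) (ℤP.abs-* x y) pᴺ∣x*y))

  -- w^p − w = (w^{p−1} − 1) w and p divides exactly one factor: w when μ = 0, the other when μ ≠ 0.
  lift-of-zero : ∀ {p N w} → Prime p → IsTeichLiftMod p N 0 w → (+ p) ^ N ∣ w
  lift-of-zero {zero}  ()
  lift-of-zero {suc zero} ()
  lift-of-zero {p@(suc (suc m))} {N} {w} p-prime (p∣w-0 , pᴺ∣w^p-w) =
    ∣ᵤ⇒∣ (+p∤x⇒+pᴺ∣x*y⇒+pᴺ∣y p-prime N {w ^ suc m - 1ℤ} w p∤w^[p-1]-1
      (subst ((+ p) ^ N Unsigned.∣_) (trans (x^[1+n]-x≡x*[x^n-1] w (suc m)) (ℤP.*-comm w _)) pᴺ∣w^p-w))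
    where
    p∣w^[p-1] : + p ∣ w ^ suc m
    p∣w^[p-1] = ∣m⇒∣m*n {m = w} (w ^ m) (∣ᵤ⇒∣ (subst (+ p Unsigned.∣_) (ℤP.+-identityʳ w) p∣w-0))
    cancel : ∀ W → W - (W - 1ℤ) ≡ 1ℤ
    cancel = solve-∀
    p∤w^[p-1]-1 : ¬ (+ p Unsigned.∣ w ^ suc m - 1ℤ)
    p∤w^[p-1]-1 p∣w^[p-1]-1 = ¬prime[1] (subst Prime (ℕD.∣1⇒≡1 (∣⇒∣ᵤ (subst (+ p ∣_) (cancel (w ^ suc m))
      (∣m∣n⇒∣m-n p∣w^[p-1] (∣ᵤ⇒∣ {i = w ^ suc m - 1ℤ} p∣w^[p-1]-1))))) p-prime)

  lift-of-unit : ∀ {p N μ w} → Prime p → 0 ℕ.< μ → μ ℕ.< p → IsTeichLiftMod p N μ w →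
    (+ p) ^ N ∣ w ^ (p ∸ 1) - 1ℤ
  lift-of-unit {zero} ()
  lift-of-unit {p@(suc m)} {N} {μ} {w} p-prime 0<μ μ<p (p∣w-μ , pᴺ∣w^p-w) =
    ∣ᵤ⇒∣ (+p∤x⇒+pᴺ∣x*y⇒+pᴺ∣y p-prime N {w} (w ^ m - 1ℤ) p∤w
      (subst ((+ p) ^ N Unsigned.∣_) (x^[1+n]-x≡x*[x^n-1] w m) pᴺ∣w^p-w))
    where
    instance _ = ℕ.>-nonZero 0<μ
    cancel : ∀ w m → w - (w - m) ≡ m
    cancel = solve-∀
    p∤w : ¬ (+ p Unsigned.∣ w)
    p∤w p∣w = ℕD.>⇒∤ μ<p (∣⇒∣ᵤ (subst (+ p ∣_) (cancel w (+ μ))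
      (∣m∣n⇒∣m-n (∣ᵤ⇒∣ {i = w} p∣w) (∣ᵤ⇒∣ {i = w - + μ} p∣w-μ))))

open import Defs
open import Data.Nat using (ℕ; _<_; _∸_; _+_)
open import Data.Nat.Divisibility using (_∣_)
open import Data.Nat.Primality using (Prime)
open import Data.Integer as ℤ using (ℤ; +_; -_)
open import Data.Product using (_×_)
open import Relation.Binary.PropositionalEquality using (_≡_; _≢_)

open import Data.Nat using (zero; suc; s≤s)
open import Data.Nat.Properties using (n≢0⇒n>0)
open import Data.Integer.Divisibility.Signed using (∣m⇒∣-m)
open import Data.Product using (_,_)
open import Relation.Binary.PropositionalEquality using (refl)
open Polynomials using (linear-power-difference-∣a; linear-power-difference-unit)
open TeichmüllerLifts
  using (binomial-term-∣; lift-of-zero; lift-of-unit; odd-prime⇒2∣p-1; ∣x^k-1⇒∣[-x]^m-1)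

lemma2p3 : (p : ℕ) → Prime p → 2 < p → (r : ℕ) → 1 < r → (p ∸ 1) ∣ (r ∸ 1) →
    (t : ℕ) → IsPadicVal p (r ∸ 1) t →
    (μ : ℕ) → μ < p → (w : ℤ) → IsTeichLiftMod p (t + 2) μ w →
    ((μ ≡ 0 →
       (pow (scale (ℤ.- w) X ⊕ scale (+ p) Y) r ⊖ (pow X (r ∸ 1) ⊗ (scale (ℤ.- w) X ⊕ scale (+ p) Y)))
         ≈ mono (ℤ.- (+ p)) (r ∸ 1) 1 [mod (+ p) ℤ.^ (t + 2) ])
    × (μ ≢ 0 →
       (pow (scale (ℤ.- w) X ⊕ scale (+ p) Y) r ⊖ (pow X (r ∸ 1) ⊗ (scale (ℤ.- w) X ⊕ scale (+ p) Y)))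
         ≈ mono ((+ (r ∸ 1)) ℤ.* (+ p)) (r ∸ 1) 1 [mod (+ p) ℤ.^ (t + 2) ]))
lemma2p3 _ _ _ zero          ()
lemma2p3 _ _ _ (suc zero)    (s≤s ())
lemma2p3 p p-prime 2<p (suc (suc n)) _ p-1∣r-1 t (pᵗ∣r-1 , _) μ μ<p w lift =
    (λ { refl → linear-power-difference-∣a {a = - w} n (∣m⇒∣-m (lift-of-zero {N = t + 2} p-prime lift)) higher })
  , λ μ≢0 → linear-power-difference-unit {a = - w} (suc n)
      (∣x^k-1⇒∣[-x]^m-1 w (odd-prime⇒2∣p-1 p-prime 2<p) p-1∣r-1
        (lift-of-unit {N = t + 2} p-prime (n≢0⇒n>0 μ≢0) μ<p lift))
      higher
  where
  higher = binomial-term-∣ {t = t} p-prime 2<p pᵗ∣r-1
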